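{- For every real $\alpha \notin [-1,1]$, there exist a finite set $V$ with $|V| = n \geq 2$, a symmetric submodular function $f: 2^V \to \mathbb{R}$, and an $\alpha$-ordering $(v_1,\dots,v_n)$ of $V$ with respect to $f$ such that $(v_{n-1}, v_n)$ is not a contractible pair with respect to $f$.
   Context: A set function $f$ on $V$ is symmetric if $f(X) = f(V\setminus X)$ for all $X \subseteq V$. For an ordering $(v_1,\dots,v_n)$ of $V$, write $V_0 := \varnothing$ and $V_i := \{v_1,\dots,v_i\}$. For $\alpha \in \mathbb{R}$, an ordering $(v_1,\dots,v_n)$ of $V$ is an $\alpha$-ordering with respect to $f$ if $f(V_{i-1}\cup\{v_i\}) + \alpha f(\{v_i\}) \leq f(V_{i-1}\cup\{v_j\}) + \alpha f(\{v_j\})$ for every pair $(i,j)$ with $1 \leq i \leq j \leq n$. A pair $(u,v)$ of distinct elements of $V$ is a contractible pair with respect to $f$ if $f(X) \geq \min_{x\in V} f(\{x\})$ for every $X \subsetneq V$ with $|X \cap \{u,v\}| = 1$. -}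

module Defs where

open import Level using (0ℓ)
open import Data.Nat using (ℕ; zero; suc)
open import Data.Bool using (Bool)
open import Data.Fin using (Fin; toℕ; fromℕ; inject₁)
open import Data.Fin.Subset using (Subset; ⁅_⁆; ∁; _∪_; _∩_; ∣_∣; ⊤)
open import Data.Fin.Permutation using (Permutation′; _⟨$⟩ʳ_; _⟨$⟩ˡ_)
open import Data.Vec using (tabulate)
open import Data.Product using (Σ; ∃; _×_; _,_)
open import Relation.Nullary using (¬_)
open import Relation.Nullary.Decidable using (⌊_⌋)
open import Relation.Binary.PropositionalEquality using (_≡_)
open import Relation.Binary.Structures using (IsTotalOrder)
open import Algebra.Structures using (IsCommutativeRing)
import Data.Nat as ℕ

-- The real numbers, axiomatised as a complete ordered field.
-- Any two models are isomorphic, so quantifying over all models is the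
-- same as speaking about ℝ.

record RealField : Set₁ where
  infixl 6 _+_
  infixl 7 _*_
  infix  4 _≤_ _<_
  field
    ℝ   : Set
    _+_ _*_ : ℝ → ℝ → ℝ
    -_  : ℝ → ℝ
    0ℝ 1ℝ : ℝ
    _≤_ : ℝ → ℝ → Set
    isCommutativeRing : IsCommutativeRing _≡_ _+_ _*_ -_ 0ℝ 1ℝ
    0≢1     : ¬ (0ℝ ≡ 1ℝ)
    inverse : ∀ x → ¬ (x ≡ 0ℝ) → ∃ λ y → x * y ≡ 1ℝ
    isTotalOrder : IsTotalOrder _≡_ _≤_
    +-mono-≤ : ∀ {x y} z → x ≤ y → x + z ≤ y + z
    *-nonneg : ∀ {x y} → 0ℝ ≤ x → 0ℝ ≤ y → 0ℝ ≤ x * y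
    complete : (P : ℝ → Set) → (∃ λ x → P x) →
               (∃ λ b → ∀ x → P x → x ≤ b) →
               ∃ λ s → (∀ x → P x → x ≤ s) ×
                       (∀ b → (∀ x → P x → x ≤ b) → s ≤ b)

  _<_ : ℝ → ℝ → Set
  x < y = x ≤ y × ¬ (x ≡ y)

module SetFunctions (R : RealField) where
  open RealField R

  SetFn : ℕ → Set
  SetFn n = Subset n → ℝ

  Symmetric : ∀ {n} → SetFn n → Set
  Symmetric f = ∀ X → f X ≡ f (∁ X)

  Submodular : ∀ {n} → SetFn n → Set
  Submodular f = ∀ X Y → f (X ∪ Y) + f (X ∩ Y) ≤ f X + f Y

  -- An ordering (v_1,…,v_n) is a permutation π with v_{k+1} = π ⟨$⟩ʳ k
  -- (0-indexed positions k).  prefix π i = V_i = {v_1,…,v_i}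
  -- = elements at 0-indexed positions < i.
  prefix : ∀ {n} → Permutation′ n → ℕ → Subset n
  prefix π i = tabulate λ v → ⌊ toℕ (π ⟨$⟩ˡ v) ℕ.<? i ⌋

  -- α-ordering: for 1 ≤ i ≤ j ≤ n (here 0-indexed i ≤ j),
  -- f(V_{i-1} ∪ {v_i}) + α f({v_i}) ≤ f(V_{i-1} ∪ {v_j}) + α f({v_j}).
  IsαOrdering : ∀ {n} → ℝ → SetFn n → Permutation′ n → Set
  IsαOrdering α f π = ∀ (i j : Fin _) → toℕ i ℕ.≤ toℕ j →
    f (prefix π (toℕ i) ∪ ⁅ π ⟨$⟩ʳ i ⁆) + α * f ⁅ π ⟨$⟩ʳ i ⁆
      ≤ f (prefix π (toℕ i) ∪ ⁅ π ⟨$⟩ʳ j ⁆) + α * f ⁅ π ⟨$⟩ʳ j ⁆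

  IsMinSingleton : ∀ {n} → SetFn n → ℝ → Set
  IsMinSingleton f m = (∃ λ x → m ≡ f ⁅ x ⁆) × (∀ x → m ≤ f ⁅ x ⁆)

  ContractiblePair : ∀ {n} → SetFn n → Fin n → Fin n → Set
  ContractiblePair f u v = ¬ (u ≡ v) ×
    (∀ X → ¬ (X ≡ ⊤) → ∣ X ∩ (⁅ u ⁆ ∪ ⁅ v ⁆) ∣ ≡ 1 →
       ∀ m → IsMinSingleton f m → m ≤ f X)

-- Put e = |α| - 1 > 0 and f = a + e·b for two natural-valued symmetric submodular functions a, b
-- on V = {0,1,2,3}; a depends on the sign of α. Once α is replaced by ±(1 + e), every inequality
-- to be checked compares two polynomials in e with natural coefficients, and it holds because it
-- already holds coefficientwise, a finite check done by evaluation. The pair (v₃, v₄) = (2, 3) is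
-- not contractible: X = {0,2} meets it in one element, but f(X) = 2 < 2 + e = min f({x}).
module Submission where

open import Defs
open import Data.Nat using (ℕ; suc)
open import Data.Fin using (fromℕ; inject₁)
open import Data.Fin.Permutation using (Permutation′; _⟨$⟩ʳ_)
open import Data.Fin.Subset using (Subset)
open import Data.Product using (Σ; ∃; _×_)
open import Data.Sum using (_⊎_)
open import Relation.Nullary using (¬_)

open import Level using (0ℓ)
open import Function using (_∘_)
import Data.Nat as ℕ
open import Data.Nat using (zero; z≤n; s≤s)
open import Data.Bool using (true; false)
open import Data.Vec using ([]; _∷_)
import Data.Fin as Fin
open import Data.Fin using (Fin; toℕ)
open import Data.Fin.Properties using (all?)
open import Data.Fin.Subset using (_∪_; _∩_; ∁; ⁅_⁆; ∣_∣; ⊤)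
open import Data.Fin.Subset.Properties using (anySubset?)
import Data.Fin.Permutation as Permutation
open import Data.Product using (_,_; proj₁; proj₂)
open import Data.Product.Properties using (≡-dec)
open import Data.Product.Relation.Binary.Pointwise.NonDependent using (Pointwise; ×-decidable)
open import Data.Sum using (inj₁; inj₂)
open import Relation.Nullary using (Dec; yes; no; ¬?)
open import Relation.Nullary.Decidable using (decidable-stable; from-yes; _→-dec_)
open import Relation.Unary using (Pred)
import Relation.Unary as U
import Relation.Binary as B
open import Relation.Binary.PropositionalEquality
open import Relation.Binary.Structures using (IsTotalOrder)
open import Algebra.Bundles using (CommutativeRing)
import Algebra.Properties.Ring as RingProperties
import Algebra.Properties.Semiring.Mult.TCOptimised as Multiplication
import Algebra.Solver.Ring.NaturalCoefficients.Default as Solver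

allSubset? : ∀ {n ℓ} {P : Pred (Subset n) ℓ} → U.Decidable P → Dec (∀ X → P X)
allSubset? P? with anySubset? (¬? ∘ P?)
... | yes (X , ¬PX) = no λ ∀P → ¬PX (∀P X)
... | no ¬∃¬P = yes λ X → decidable-stable (P? X) (λ ¬PX → ¬∃¬P (X , ¬PX))

-- Coefficient vectors (c₀ , c₁) and (c₀ , c₁ , c₂) of polynomials in e.
Poly₁ : Set
Poly₁ = ℕ × ℕ

Poly₂ : Set
Poly₂ = ℕ × Poly₁

infixl 6 _+₁_ _+[1+e]*_
infix  4 _≤₁_ _≤₁?_ _≤₂_ _≤₂?_ _≼⁺_ _≼⁻_ _≼⁺?_ _≼⁻?_

_+₁_ : Poly₁ → Poly₁ → Poly₁
(x₀ , x₁) +₁ (y₀ , y₁) = x₀ ℕ.+ y₀ , x₁ ℕ.+ y₁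

_+[1+e]*_ : Poly₁ → Poly₁ → Poly₂
(x₀ , x₁) +[1+e]* (y₀ , y₁) = x₀ ℕ.+ y₀ , x₁ ℕ.+ (y₀ ℕ.+ y₁) , y₁

_≤₁_ : Poly₁ → Poly₁ → Set
_≤₁_ = Pointwise ℕ._≤_ ℕ._≤_

_≤₁?_ : B.Decidable _≤₁_
_≤₁?_ = ×-decidable ℕ._≤?_ ℕ._≤?_

_≤₂_ : Poly₂ → Poly₂ → Set
_≤₂_ = Pointwise ℕ._≤_ _≤₁_

_≤₂?_ : B.Decidable _≤₂_
_≤₂?_ = ×-decidable ℕ._≤?_ _≤₁?_

-- A side (f(V_{i-1} ∪ {v}) , f({v})) of the α-ordering inequality, compared for α = 1 + e and
-- for α = -(1 + e); in the second case x + α y ≤ z + α w iff x + (1 + e) w ≤ z + (1 + e) y.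
_≼⁺_ _≼⁻_ : Poly₁ × Poly₁ → Poly₁ × Poly₁ → Set
(x , y) ≼⁺ (z , w) = x +[1+e]* y ≤₂ z +[1+e]* w
(x , y) ≼⁻ (z , w) = x +[1+e]* w ≤₂ z +[1+e]* y

_≼⁺?_ : B.Decidable _≼⁺_
(x , y) ≼⁺? (z , w) = x +[1+e]* y ≤₂? z +[1+e]* w

_≼⁻?_ : B.Decidable _≼⁻_
(x , y) ≼⁻? (z , w) = x +[1+e]* w ≤₂? z +[1+e]* y

IsSymmetric₁ : ∀ {n} → (Subset n → Poly₁) → Set
IsSymmetric₁ h = ∀ X → h X ≡ h (∁ X)

IsSubmodular₁ : ∀ {n} → (Subset n → Poly₁) → Set
IsSubmodular₁ h = ∀ X Y → h (X ∪ Y) +₁ h (X ∩ Y) ≤₁ h X +₁ h Y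

IsMinSingleton₁ : ∀ {n} → (Subset n → Poly₁) → Fin n → Set
IsMinSingleton₁ h x₀ = ∀ x → h ⁅ x₀ ⁆ ≤₁ h ⁅ x ⁆

isSymmetric₁? : ∀ {n} (h : Subset n → Poly₁) → Dec (IsSymmetric₁ h)
isSymmetric₁? h = allSubset? λ X → ≡-dec ℕ._≟_ ℕ._≟_ (h X) (h (∁ X))

isSubmodular₁? : ∀ {n} (h : Subset n → Poly₁) → Dec (IsSubmodular₁ h)
isSubmodular₁? h = allSubset? λ X → allSubset? λ Y → h (X ∪ Y) +₁ h (X ∩ Y) ≤₁? h X +₁ h Y

isMinSingleton₁? : ∀ {n} (h : Subset n → Poly₁) x₀ → Dec (IsMinSingleton₁ h x₀)
isMinSingleton₁? h x₀ = all? λ x → h ⁅ x₀ ⁆ ≤₁? h ⁅ x ⁆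

cutFunction : Poly₁ → Poly₁ → Subset 4 → Poly₁
cutFunction s t (false ∷ false ∷ false ∷ false ∷ []) = 0 , 0
cutFunction s t (true  ∷ true  ∷ true  ∷ true  ∷ []) = 0 , 0
cutFunction s t (true  ∷ false ∷ false ∷ false ∷ []) = s
cutFunction s t (false ∷ true  ∷ false ∷ false ∷ []) = s
cutFunction s t (false ∷ false ∷ true  ∷ false ∷ []) = t
cutFunction s t (false ∷ false ∷ false ∷ true  ∷ []) = t
cutFunction s t (false ∷ true  ∷ true  ∷ true  ∷ []) = s
cutFunction s t (true  ∷ false ∷ true  ∷ true  ∷ []) = s
cutFunction s t (true  ∷ true  ∷ false ∷ true  ∷ []) = t
cutFunction s t (true  ∷ true  ∷ true  ∷ false ∷ []) = t
cutFunction s t (true  ∷ false ∷ true  ∷ false ∷ []) = 2 , 0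
cutFunction s t (false ∷ true  ∷ false ∷ true  ∷ []) = 2 , 0
cutFunction s t (true  ∷ true  ∷ false ∷ false ∷ []) = 4 , 2
cutFunction s t (false ∷ false ∷ true  ∷ true  ∷ []) = 4 , 2
cutFunction s t (true  ∷ false ∷ false ∷ true  ∷ []) = 6 , 2
cutFunction s t (false ∷ true  ∷ true  ∷ false ∷ []) = 6 , 2

h⁺ h⁻ : Subset 4 → Poly₁
h⁺ = cutFunction (2 , 1) (4 , 1)
h⁻ = cutFunction (4 , 1) (2 , 1)

X₀₂ : Subset 4
X₀₂ = true ∷ false ∷ true ∷ false ∷ []

h⁺-symmetric : IsSymmetric₁ h⁺
h⁺-symmetric = from-yes (isSymmetric₁? h⁺)

h⁻-symmetric : IsSymmetric₁ h⁻
h⁻-symmetric = from-yes (isSymmetric₁? h⁻)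

h⁺-submodular : IsSubmodular₁ h⁺
h⁺-submodular = from-yes (isSubmodular₁? h⁺)

h⁻-submodular : IsSubmodular₁ h⁻
h⁻-submodular = from-yes (isSubmodular₁? h⁻)

h⁺-min : IsMinSingleton₁ h⁺ Fin.zero
h⁺-min = from-yes (isMinSingleton₁? h⁺ Fin.zero)

h⁻-min : IsMinSingleton₁ h⁻ (Fin.suc (Fin.suc Fin.zero))
h⁻-min = from-yes (isMinSingleton₁? h⁻ (Fin.suc (Fin.suc Fin.zero)))

module OverReals (R : RealField) where
  open RealField R
  open SetFunctions R
  open IsTotalOrder isTotalOrder using (antisym; total) renaming (refl to ≤-refl; trans to ≤-trans)

  commutativeRing : CommutativeRing 0ℓ 0ℓ
  commutativeRing = record
    { Carrier = ℝ ; _≈_ = _≡_ ; _+_ = _+_ ; _*_ = _*_ ; -_ = -_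
    ; 0# = 0ℝ ; 1# = 1ℝ ; isCommutativeRing = isCommutativeRing }

  open CommutativeRing commutativeRing
    using (commutativeSemiring; semiring; ring; +-identityˡ; +-identityʳ; +-comm; +-assoc;
           -‿inverseˡ; -‿inverseʳ; zeroˡ; distribʳ; *-identityˡ)
  open RingProperties ring using (-1*x≈-x; -‿involutive; x∙y⁻¹≈ε⇒x≈y; +-identityʳ-unique)
  open Multiplication semiring using (×-homo-+) renaming (_×_ to _·_)
  open Solver commutativeSemiring using (solve; _:=_; _:+_; _:*_; con)

  -- The optimised multiplication makes ι n agree with the solver's constant con n.
  ι : ℕ → ℝ
  ι n = n · 1ℝ

  ι-+ : ∀ m n → ι (m ℕ.+ n) ≡ ι m + ι n
  ι-+ = ×-homo-+ 1ℝ

  ι-suc : ∀ n → ι (suc n) ≡ 1ℝ + ι n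
  ι-suc = ι-+ 1

  +-monoʳ-≤ : ∀ {x y} z → x ≤ y → z + x ≤ z + y
  +-monoʳ-≤ {x} {y} z x≤y = subst₂ _≤_ (+-comm x z) (+-comm y z) (+-mono-≤ z x≤y)

  +-mono₂-≤ : ∀ {x x′ y y′} → x ≤ x′ → y ≤ y′ → x + y ≤ x′ + y′
  +-mono₂-≤ {x′ = x′} {y} x≤x′ y≤y′ = ≤-trans (+-mono-≤ y x≤x′) (+-monoʳ-≤ x′ y≤y′)

  x≤x+d : ∀ {d} x → 0ℝ ≤ d → x ≤ x + d
  x≤x+d x 0≤d = subst (_≤ x + _) (+-identityʳ x) (+-monoʳ-≤ x 0≤d)

  0≤1 : 0ℝ ≤ 1ℝ
  0≤1 with total 0ℝ 1ℝ
  ... | inj₁ 0≤1′ = 0≤1′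
  ... | inj₂ 1≤0 = subst (0ℝ ≤_) (trans (-1*x≈-x (- 1ℝ)) (-‿involutive 1ℝ)) (*-nonneg 0≤-1 0≤-1)
    where
    0≤-1 : 0ℝ ≤ - 1ℝ
    0≤-1 = subst₂ _≤_ (-‿inverseʳ 1ℝ) (+-identityˡ (- 1ℝ)) (+-mono-≤ (- 1ℝ) 1≤0)

  0≤ι : ∀ n → 0ℝ ≤ ι n
  0≤ι zero    = ≤-refl
  0≤ι (suc n) = subst (0ℝ ≤_) (sym (ι-suc n)) (≤-trans 0≤1 (x≤x+d 1ℝ (0≤ι n)))

  ι-mono : ∀ {m n} → m ℕ.≤ n → ι m ≤ ι n
  ι-mono {n = n} z≤n = 0≤ι n
  ι-mono {suc m} {suc n} (s≤s m≤n) =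
    subst₂ _≤_ (sym (ι-suc m)) (sym (ι-suc n)) (+-monoʳ-≤ 1ℝ (ι-mono m≤n))

  ι*-mono : ∀ {m n t} → m ℕ.≤ n → 0ℝ ≤ t → ι m * t ≤ ι n * t
  ι*-mono {n = n} {t} z≤n 0≤t = subst (_≤ ι n * t) (sym (zeroˡ t)) (*-nonneg (0≤ι n) 0≤t)
  ι*-mono {suc m} {suc n} {t} (s≤s m≤n) 0≤t =
    subst₂ _≤_ (sym (ι-suc-* m)) (sym (ι-suc-* n)) (+-monoʳ-≤ t (ι*-mono m≤n 0≤t))
    where
    ι-suc-* : ∀ k → ι (suc k) * t ≡ t + ι k * t
    ι-suc-* k = begin
      ι (suc k) * t        ≡⟨ cong (_* t) (ι-suc k) ⟩
      (1ℝ + ι k) * t       ≡⟨ distribʳ t 1ℝ (ι k) ⟩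
      1ℝ * t + ι k * t     ≡⟨ cong (_+ ι k * t) (*-identityˡ t) ⟩
      t + ι k * t          ∎
      where open ≡-Reasoning

  -‿antitone-≤ : ∀ {x y} → x ≤ y → - y ≤ - x
  -‿antitone-≤ {x} {y} x≤y = subst₂ _≤_ x-x-y≡-y y-x-y≡-x (+-mono-≤ (- x + - y) x≤y)
    where
    open ≡-Reasoning
    x-x-y≡-y : x + (- x + - y) ≡ - y
    x-x-y≡-y = begin
      x + (- x + - y)  ≡⟨ +-assoc x (- x) (- y) ⟨
      x + - x + - y    ≡⟨ cong (_+ - y) (-‿inverseʳ x) ⟩
      0ℝ + - y         ≡⟨ +-identityˡ (- y) ⟩
      - y              ∎
    y-x-y≡-x : y + (- x + - y) ≡ - x
    y-x-y≡-x = begin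
      y + (- x + - y)  ≡⟨ cong (y +_) (+-comm (- x) (- y)) ⟩
      y + (- y + - x)  ≡⟨ +-assoc y (- y) (- x) ⟨
      y + - y + - x    ≡⟨ cong (_+ - x) (-‿inverseʳ y) ⟩
      0ℝ + - x         ≡⟨ +-identityˡ (- x) ⟩
      - x              ∎

  <-1⇒1<- : ∀ {α} → α < - 1ℝ → 1ℝ < - α
  <-1⇒1<- {α} (α≤-1 , α≢-1) =
    subst (_≤ - α) (-‿involutive 1ℝ) (-‿antitone-≤ α≤-1) ,
    λ 1≡-α → α≢-1 (trans (sym (-‿involutive α)) (cong -_ (sym 1≡-α)))

  1<⇒≡1+e : ∀ {γ} → 1ℝ < γ → Σ ℝ λ e → 0ℝ ≤ e × ¬ e ≡ 0ℝ × γ ≡ 1ℝ + e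
  1<⇒≡1+e {γ} (1≤γ , 1≢γ) =
    γ + - 1ℝ ,
    subst (_≤ γ + - 1ℝ) (-‿inverseʳ 1ℝ) (+-mono-≤ (- 1ℝ) 1≤γ) ,
    (λ γ-1≡0 → 1≢γ (sym (x∙y⁻¹≈ε⇒x≈y γ 1ℝ γ-1≡0))) ,
    (begin
      γ                  ≡⟨ +-identityʳ γ ⟨
      γ + 0ℝ             ≡⟨ cong (γ +_) (-‿inverseˡ 1ℝ) ⟨
      γ + (- 1ℝ + 1ℝ)    ≡⟨ +-assoc γ (- 1ℝ) 1ℝ ⟨
      γ + - 1ℝ + 1ℝ      ≡⟨ +-comm (γ + - 1ℝ) 1ℝ ⟩
      1ℝ + (γ + - 1ℝ)    ∎)
    where open ≡-Reasoning

  weights-swap-≤ : ∀ {α β x y z w} → α + β ≡ 0ℝ →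
                   x + β * w ≤ z + β * y → x + α * y ≤ z + α * w
  weights-swap-≤ {α} {β} {x} {y} {z} {w} α+β≡0 ≤β =
    subst₂ _≤_ (cancel x w (α * y))
               (trans (cong (z + β * y +_) (+-comm (α * y) (α * w))) (cancel z y (α * w)))
               (+-mono-≤ (α * y + α * w) ≤β)
    where
    open ≡-Reasoning
    cancel : ∀ v u t → v + β * u + (t + α * u) ≡ v + t
    cancel v u t = begin
      v + β * u + (t + α * u)
        ≡⟨ solve 5 (λ v β u t α → v :+ β :* u :+ (t :+ α :* u) := v :+ t :+ (α :+ β) :* u) refl v β u t α ⟩
      v + t + (α + β) * u
        ≡⟨ cong (λ s → v + t + s * u) α+β≡0 ⟩
      v + t + 0ℝ * u
        ≡⟨ cong (v + t +_) (zeroˡ u) ⟩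
      v + t + 0ℝ
        ≡⟨ +-identityʳ (v + t) ⟩
      v + t
        ∎

  ¬contractible : ∀ {n} {f : SetFn n} {u v m} X → ¬ X ≡ ⊤ → ∣ X ∩ (⁅ u ⁆ ∪ ⁅ v ⁆) ∣ ≡ 1 →
                  IsMinSingleton f m → f X < m → ¬ ContractiblePair f u v
  ¬contractible X X≢⊤ |X∩uv|≡1 isMin (fX≤m , fX≢m) (_ , contractible) =
    fX≢m (antisym fX≤m (contractible X X≢⊤ |X∩uv|≡1 _ isMin))

  orderingSide : ∀ {n} → (Subset n → Poly₁) → Permutation′ n → Fin n → Fin n → Poly₁ × Poly₁
  orderingSide h π i k = h (prefix π (toℕ i) ∪ ⁅ π ⟨$⟩ʳ k ⁆) , h ⁅ π ⟨$⟩ʳ k ⁆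

  CoefficientOrdering : ∀ {n} → (Poly₁ × Poly₁ → Poly₁ × Poly₁ → Set) →
                        (Subset n → Poly₁) → Permutation′ n → Set
  CoefficientOrdering _≼_ h π =
    ∀ i j → toℕ i ℕ.≤ toℕ j → orderingSide h π i i ≼ orderingSide h π i j

  coefficientOrdering? : ∀ {n} {_≼_ : Poly₁ × Poly₁ → Poly₁ × Poly₁ → Set} → B.Decidable _≼_ →
                         (h : Subset n → Poly₁) (π : Permutation′ n) → Dec (CoefficientOrdering _≼_ h π)
  coefficientOrdering? _≼?_ h π =
    all? λ i → all? λ j → toℕ i ℕ.≤? toℕ j →-dec orderingSide h π i i ≼? orderingSide h π i j

  h⁺-ordering : CoefficientOrdering _≼⁺_ h⁺ Permutation.id
  h⁺-ordering = from-yes (coefficientOrdering? _≼⁺?_ h⁺ Permutation.id)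

  h⁻-ordering : CoefficientOrdering _≼⁻_ h⁻ Permutation.id
  h⁻-ordering = from-yes (coefficientOrdering? _≼⁻?_ h⁻ Permutation.id)

  module Evaluation (e : ℝ) (0≤e : 0ℝ ≤ e) where

    ⟦_⟧₁ : Poly₁ → ℝ
    ⟦ c₀ , c₁ ⟧₁ = ι c₀ + ι c₁ * e

    ⟦_⟧₂ : Poly₂ → ℝ
    ⟦ c₀ , c₁ , c₂ ⟧₂ = ι c₀ + ι c₁ * e + ι c₂ * (e * e)

    ⟦_⟧ᶠ : ∀ {n} → (Subset n → Poly₁) → SetFn n
    ⟦ h ⟧ᶠ = ⟦_⟧₁ ∘ h

    ⟦⟧₁-mono : ∀ {p q} → p ≤₁ q → ⟦ p ⟧₁ ≤ ⟦ q ⟧₁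
    ⟦⟧₁-mono (p₀≤q₀ , p₁≤q₁) = +-mono₂-≤ (ι-mono p₀≤q₀) (ι*-mono p₁≤q₁ 0≤e)

    ⟦⟧₂-mono : ∀ {p q} → p ≤₂ q → ⟦ p ⟧₂ ≤ ⟦ q ⟧₂
    ⟦⟧₂-mono (p₀≤q₀ , p₁≤q₁ , p₂≤q₂) =
      +-mono₂-≤ (+-mono₂-≤ (ι-mono p₀≤q₀) (ι*-mono p₁≤q₁ 0≤e)) (ι*-mono p₂≤q₂ (*-nonneg 0≤e 0≤e))

    ⟦⟧₁-homo : ∀ p q → ⟦ p +₁ q ⟧₁ ≡ ⟦ p ⟧₁ + ⟦ q ⟧₁
    ⟦⟧₁-homo (x₀ , x₁) (y₀ , y₁) = begin
      ι (x₀ ℕ.+ y₀) + ι (x₁ ℕ.+ y₁) * e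
        ≡⟨ cong₂ (λ a b → a + b * e) (ι-+ x₀ y₀) (ι-+ x₁ y₁) ⟩
      (ι x₀ + ι y₀) + (ι x₁ + ι y₁) * e
        ≡⟨ solve 5 (λ a₀ b₀ a₁ b₁ e → (a₀ :+ b₀) :+ (a₁ :+ b₁) :* e := (a₀ :+ a₁ :* e) :+ (b₀ :+ b₁ :* e))
                   refl (ι x₀) (ι y₀) (ι x₁) (ι y₁) e ⟩
      (ι x₀ + ι x₁ * e) + (ι y₀ + ι y₁ * e)
        ∎
      where open ≡-Reasoning

    ⟦+[1+e]*⟧ : ∀ p q → ⟦ p +[1+e]* q ⟧₂ ≡ ⟦ p ⟧₁ + (1ℝ + e) * ⟦ q ⟧₁
    ⟦+[1+e]*⟧ (x₀ , x₁) (y₀ , y₁) = begin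
      ι (x₀ ℕ.+ y₀) + ι (x₁ ℕ.+ (y₀ ℕ.+ y₁)) * e + ι y₁ * (e * e)
        ≡⟨ cong₂ (λ a b → a + b * e + ι y₁ * (e * e))
                 (ι-+ x₀ y₀) (trans (ι-+ x₁ _) (cong (ι x₁ +_) (ι-+ y₀ y₁))) ⟩
      (ι x₀ + ι y₀) + (ι x₁ + (ι y₀ + ι y₁)) * e + ι y₁ * (e * e)
        ≡⟨ solve 5 (λ a₀ a₁ b₀ b₁ e →
             (a₀ :+ b₀) :+ (a₁ :+ (b₀ :+ b₁)) :* e :+ b₁ :* (e :* e)
             := (a₀ :+ a₁ :* e) :+ (con 1 :+ e) :* (b₀ :+ b₁ :* e))
           refl (ι x₀) (ι x₁) (ι y₀) (ι y₁) e ⟩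
      (ι x₀ + ι x₁ * e) + (1ℝ + e) * (ι y₀ + ι y₁ * e)
        ∎
      where open ≡-Reasoning

    ⟦⟧₁-strict : ¬ e ≡ 0ℝ → ∀ a b → ⟦ a , b ⟧₁ < ⟦ a , suc b ⟧₁
    ⟦⟧₁-strict e≢0 a b =
      subst (⟦ a , b ⟧₁ ≤_) (sym ≡+e) (x≤x+d _ 0≤e) ,
      λ eq → e≢0 (+-identityʳ-unique ⟦ a , b ⟧₁ e (sym (trans eq ≡+e)))
      where
      ≡+e : ⟦ a , suc b ⟧₁ ≡ ⟦ a , b ⟧₁ + e
      ≡+e = begin
        ι a + ι (suc b) * e     ≡⟨ cong (λ s → ι a + s * e) (ι-suc b) ⟩
        ι a + (1ℝ + ι b) * e    ≡⟨ solve 3 (λ a b e → a :+ (con 1 :+ b) :* e := a :+ b :* e :+ e)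
                                          refl (ι a) (ι b) e ⟩
        ι a + ι b * e + e       ∎
        where open ≡-Reasoning

    weighted : Poly₁ × Poly₁ → ℝ
    weighted (x , y) = ⟦ x ⟧₁ + (1ℝ + e) * ⟦ y ⟧₁

    ≼⁺-sound : ∀ p q → p ≼⁺ q → weighted p ≤ weighted q
    ≼⁺-sound (x , y) (z , w) ≤₂ = subst₂ _≤_ (⟦+[1+e]*⟧ x y) (⟦+[1+e]*⟧ z w) (⟦⟧₂-mono ≤₂)

    ≼⁻-sound : ∀ p q → p ≼⁻ q → weighted (proj₁ p , proj₂ q) ≤ weighted (proj₁ q , proj₂ p)
    ≼⁻-sound (x , y) (z , w) = ≼⁺-sound (x , w) (z , y)

    symmetric : ∀ {n} (h : Subset n → Poly₁) → IsSymmetric₁ h → Symmetric ⟦ h ⟧ᶠ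
    symmetric h h-symmetric X = cong ⟦_⟧₁ (h-symmetric X)

    submodular : ∀ {n} (h : Subset n → Poly₁) → IsSubmodular₁ h → Submodular ⟦ h ⟧ᶠ
    submodular h h-submodular X Y =
      subst₂ _≤_ (⟦⟧₁-homo (h (X ∪ Y)) (h (X ∩ Y))) (⟦⟧₁-homo (h X) (h Y))
                 (⟦⟧₁-mono (h-submodular X Y))

    isMinSingleton : ∀ {n} (h : Subset n → Poly₁) x₀ →
                     IsMinSingleton₁ h x₀ → IsMinSingleton ⟦ h ⟧ᶠ ⟦ h ⁅ x₀ ⁆ ⟧₁
    isMinSingleton h x₀ h-min = (x₀ , refl) , λ x → ⟦⟧₁-mono (h-min x)

    isαOrdering⁺ : ∀ {n α} (h : Subset n → Poly₁) π → α ≡ 1ℝ + e →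
                   CoefficientOrdering _≼⁺_ h π → IsαOrdering α ⟦ h ⟧ᶠ π
    isαOrdering⁺ h π refl ordering i j i≤j =
      ≼⁺-sound (orderingSide h π i i) (orderingSide h π i j) (ordering i j i≤j)

    isαOrdering⁻ : ∀ {n α} (h : Subset n → Poly₁) π → - α ≡ 1ℝ + e →
                   CoefficientOrdering _≼⁻_ h π → IsαOrdering α ⟦ h ⟧ᶠ π
    isαOrdering⁻ {α = α} h π -α≡1+e ordering i j i≤j =
      weights-swap-≤ α+1+e≡0 (≼⁻-sound (orderingSide h π i i) (orderingSide h π i j) (ordering i j i≤j))
      where
      α+1+e≡0 : α + (1ℝ + e) ≡ 0ℝ
      α+1+e≡0 = trans (cong (α +_) (sym -α≡1+e)) (-‿inverseʳ α)

open RealField using (ℝ; 1ℝ; -_; _<_)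
open SetFunctions using (Symmetric; Submodular; IsαOrdering; ContractiblePair)

proposition1 : (R : RealField) → (α : ℝ R) →
    (_<_ R α (-_ R (1ℝ R)) ⊎ _<_ R (1ℝ R) α) →
    ∃ λ (m : ℕ) → Σ (Subset (suc (suc m)) → ℝ R) λ f →
    Symmetric R f × Submodular R f ×
    Σ (Permutation′ (suc (suc m))) λ π → IsαOrdering R α f π ×
    ¬ ContractiblePair R f (π ⟨$⟩ʳ inject₁ (fromℕ m)) (π ⟨$⟩ʳ fromℕ (suc m))
proposition1 R α (inj₂ 1<α) with OverReals.1<⇒≡1+e R 1<α
... | e , 0≤e , e≢0 , α≡1+e =
  2 , ⟦ h⁺ ⟧ᶠ , symmetric h⁺ h⁺-symmetric , submodular h⁺ h⁺-submodular , Permutation.id ,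
  isαOrdering⁺ h⁺ Permutation.id α≡1+e h⁺-ordering ,
  ¬contractible X₀₂ (λ ()) refl (isMinSingleton h⁺ Fin.zero h⁺-min) (⟦⟧₁-strict e≢0 2 0)
  where open OverReals R; open Evaluation e 0≤e
proposition1 R α (inj₁ α<-1) with OverReals.1<⇒≡1+e R (OverReals.<-1⇒1<- R α<-1)
... | e , 0≤e , e≢0 , -α≡1+e =
  2 , ⟦ h⁻ ⟧ᶠ , symmetric h⁻ h⁻-symmetric , submodular h⁻ h⁻-submodular , Permutation.id ,
  isαOrdering⁻ h⁻ Permutation.id -α≡1+e h⁻-ordering ,
  ¬contractible X₀₂ (λ ()) refl (isMinSingleton h⁻ (Fin.suc (Fin.suc Fin.zero)) h⁻-min) (⟦⟧₁-strict e≢0 2 0)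
  where open OverReals R; open Evaluation e 0≤e
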